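{- Let $Q$ be a key with vertices $\{k,k'\}$ such that $k$ is a sink or a source. (1) If $R=\mu_k(Q)$, then $R$ is an acyclic quiver with $R^k_{k'}=R_0\setminus\{k,k'\}$, and $\mu_r(R)$ is a fork with point of return $r$ for all $r\neq k,k'$. (2) If $P=\mu_{[k,k']}(Q)$, then $P$ is a key with vertices $\{k,k'\}$, and for all vertices $i\neq k,k'$ we have $p_{ik}=-q_{ik}$, $p_{ik'}=-q_{ik'}$, and $p_{kk'}=q_{kk'}$. (3) If $k'$ is not a sink or a source in $Q$, then $R'=\mu_{k'}(Q)$ is a non-acyclic quiver with $(R')^k_{k'}=R'_0\setminus\{k,k'\}$, and $\mu_r(R')$ is a fork with point of return $r$ for all $r\neq k,k'$. (4) If $k'$ is not a sink or a source in $Q$, then $P'=\mu_{[k',k]}(Q)$ is a non-acyclic quiver with $(P')^k_{k'}=P'_0\setminus\{k,k'\}$, and $\mu_r(P')$ is a fork with point of return $r$ for all $r\neq k,k'$. Additionally, for each of the four quivers $R,P,R',P'$, the number (and direction) of arrows between $i$ and $j$ equals $q_{ij}$ for all vertices $i,j\neq k,k'$.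
   Context: A quiver is a finite directed multigraph with vertex set $Q_0$, no loops and no 2-cycles; $q_{ij}$ is the number of arrows $i\to j$ if positive and minus the number of arrows $j\to i$ otherwise (similarly $p_{ij}$ for $P$). Mutation $\mu_v$: $q'_{ab}=-q_{ab}$ if $v\in\{a,b\}$, else $q'_{ab}=q_{ab}+\max(q_{av},0)\max(q_{vb},0)-\max(q_{bv},0)\max(q_{va},0)$; $\mu_{[a,b]}$ means mutate at $a$ then at $b$. $Q\setminus V$ is the full subquiver on the vertices not in $V$. $Q^+(v)=\{j:q_{vj}>0\}$, $Q^-(v)=\{j:q_{jv}>0\}$, $Q^k_{k'}=(Q^+(k)\cap Q^-(k'))\cup(Q^+(k')\cap Q^-(k))$. Abundant: at least two arrows between every pair of distinct vertices; acyclic: no directed cycle; source (sink): only outgoing (incoming) arrows. A fork is an abundant, non-acyclic quiver $F$ with a vertex $r$ (point of return) such that for all $i\in F^-(r)$, $j\in F^+(r)$: $f_{ji}>f_{ir}$ and $f_{ji}>f_{rj}$, and the full subquivers on $F^-(r)$, $F^+(r)$ are acyclic. A key with vertices $\{k,k'\}$ ($k\ne k'$) is a quiver $Q$ with $Q\setminus\{k\}$ and $Q\setminus\{k'\}$ abundant acyclic and such that for each vertex $i\notin\{k,k'\}$ either ($k\to i$ and $k'\to i$) or ($i\to k$ and $i\to k'$); any number (possibly zero) of arrows between $k$ and $k'$. -}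

module Defs where

open import Data.Nat using (ℕ; suc; _≤_)
open import Data.Fin using (Fin; _≟_)
open import Data.Integer using (ℤ; 0ℤ; _+_; _-_; _*_; -_; _⊔_; _<_; ∣_∣)
open import Data.Product using (Σ; ∃; _×_; _,_)
open import Data.Sum using (_⊎_)
open import Data.Unit using (⊤)
open import Relation.Nullary using (¬_; yes; no)
open import Relation.Binary.PropositionalEquality using (_≡_; _≢_)

-- A quiver on vertex set Fin n is encoded by its exchange matrix:
-- q i j = #arrows i→j if positive, minus #arrows j→i otherwise.
Mat : ℕ → Set
Mat n = Fin n → Fin n → ℤ

-- Well-formedness: skew-symmetry (forces no loops; no 2-cycles is built in).
IsQuiver : ∀ {n} → Mat n → Set
IsQuiver {n} Q = ∀ (i j : Fin n) → Q i j ≡ - Q j i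

μ : ∀ {n} → Fin n → Mat n → Mat n
μ v Q a b with a ≟ v | b ≟ v
... | yes _ | _     = - Q a b
... | no _  | yes _ = - Q a b
... | no _  | no _  =
  Q a b + ((Q a v ⊔ 0ℤ) * (Q v b ⊔ 0ℤ)) - ((Q b v ⊔ 0ℤ) * (Q v a ⊔ 0ℤ))

μ[_,_] : ∀ {n} → Fin n → Fin n → Mat n → Mat n
μ[ a , b ] Q = μ b (μ a Q)

DirectedCycleIn : ∀ {n} → Mat n → (Fin n → Set) → Set
DirectedCycleIn {n} Q S =
  Σ ℕ λ ℓ → Σ (ℕ → Fin n) λ v →
    (1 ≤ ℓ) × (v ℓ ≡ v 0) ×
    (∀ t → suc t ≤ ℓ → S (v t) × (0ℤ < Q (v t) (v (suc t))))

AcyclicOn : ∀ {n} → Mat n → (Fin n → Set) → Set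
AcyclicOn Q S = ¬ DirectedCycleIn Q S

AbundantOn : ∀ {n} → Mat n → (Fin n → Set) → Set
AbundantOn {n} Q S = ∀ (i j : Fin n) → S i → S j → i ≢ j → 2 ≤ ∣ Q i j ∣

Everything : ∀ {n} → Fin n → Set
Everything _ = ⊤

Acyclic : ∀ {n} → Mat n → Set
Acyclic Q = AcyclicOn Q Everything

Abundant : ∀ {n} → Mat n → Set
Abundant Q = AbundantOn Q Everything

Out : ∀ {n} → Mat n → Fin n → Fin n → Set
Out Q v j = 0ℤ < Q v j

In : ∀ {n} → Mat n → Fin n → Fin n → Set
In Q v j = 0ℤ < Q j v

Qkk' : ∀ {n} → Mat n → Fin n → Fin n → Fin n → Set
Qkk' Q k k' j = (Out Q k j × In Q k' j) ⊎ (Out Q k' j × In Q k j)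

Source : ∀ {n} → Mat n → Fin n → Set
Source {n} Q v = ∀ (j : Fin n) → ¬ (0ℤ < Q j v)

Sink : ∀ {n} → Mat n → Fin n → Set
Sink {n} Q v = ∀ (j : Fin n) → ¬ (0ℤ < Q v j)

IsFork : ∀ {n} → Mat n → Fin n → Set
IsFork {n} F r =
  Abundant F × ¬ Acyclic F ×
  (∀ (i j : Fin n) → In F r i → Out F r j → (F i r < F j i) × (F r j < F j i)) ×
  AcyclicOn F (In F r) × AcyclicOn F (Out F r)

Not : ∀ {n} → Fin n → Fin n → Set
Not v i = i ≢ v

IsKey : ∀ {n} → Mat n → Fin n → Fin n → Set
IsKey {n} Q k k' =
  k ≢ k' ×
  AbundantOn Q (Not k) × AcyclicOn Q (Not k) ×
  AbundantOn Q (Not k') × AcyclicOn Q (Not k') ×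
  (∀ (i : Fin n) → i ≢ k → i ≢ k' →
     (Out Q k i × Out Q k' i) ⊎ (In Q k i × In Q k' i))

KeySetFull : ∀ {n} → Mat n → Fin n → Fin n → Set
KeySetFull {n} X k k' = ∀ (j : Fin n) →
  (Qkk' X k k' j → (j ≢ k × j ≢ k')) × ((j ≢ k × j ≢ k') → Qkk' X k k' j)

ForksAway : ∀ {n} → Mat n → Fin n → Fin n → Set
ForksAway {n} X k k' = ∀ (r : Fin n) → r ≢ k → r ≢ k' → IsFork (μ r X) r

AgreesAway : ∀ {n} → Mat n → Mat n → Fin n → Fin n → Set
AgreesAway {n} X Q k k' = ∀ (i j : Fin n) → i ≢ k → i ≢ k' → j ≢ k → j ≢ k' → X i j ≡ Q i j

-- Let Q be a key with sink k; the source case is the sink case for the opposite quiver, since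
-- transposition commutes with mutation. μ_[k,k'] only reverses the arrows at k and k'. After each of
-- μ_k, μ_k' and μ_[k',k], every vertex v ∉ {k, k'} receives at least two arrows from one of k, k' and
-- sends at least two to the other, while the arrows among these vertices are still those of Q, which
-- is abundant and acyclic there. Mutating such a quiver at one of these vertices r replaces each path
-- i → r → j by q_ij + q_ir q_rj arrows i → j, more than q_ir and q_rj as soon as -q_ij is smaller than
-- one of them. This holds when q_ij ≥ 0, which acyclicity guarantees away from the pair {k, k'}; on
-- that pair it follows from the explicit entries b + c a and - c + (b + c a) a created by the
-- mutations. Acyclicity of each of the three quivers is read off the arrows between k and k'.

module Submission where

open import Defs
open import Data.Fin using (Fin; _≟_)
open import Data.Fin.Properties using (¬∀⟶∃¬)
open import Data.Nat using (ℕ)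
import Data.Nat as N
import Data.Nat.Properties as NP
open import Data.Integer using (ℤ; +_; -[1+_]; 0ℤ; _+_; _-_; _*_; -_; _⊔_; _<_; _≤_; ∣_∣; +≤+; +<+; -<+)
open import Data.Integer.Properties
  using ( <⇒≤; ≮⇒≥; ≰⇒>; ≤⇒≯; <-irrefl; <-asym; ≤-trans; <-trans; ≤-<-trans; <-≤-trans; _≤?_; _<?_
        ; +-mono-≤; +-monoʳ-≤; +-identityʳ; *-comm; *-zeroʳ; pos-*; neg-involutive; neg-mono-≤; neg-mono-<
        ; ∣-i∣≡∣i∣; i≤j⇒i⊔j≡j; i≥j⇒i⊔j≡i; i≤j⇒0≤j-i; i<j⇒suc[i]≤j; suc[i]≤j⇒i<j )
open import Data.Integer.Tactic.RingSolver using (solve-∀)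
open import Data.Product using (Σ; ∃; ∃₂; _×_; _,_; proj₁; proj₂)
import Data.Product as Product
open import Data.Sum using (_⊎_; inj₁; inj₂; [_,_]′)
import Data.Sum as Sum
open import Data.Unit using (tt)
open import Data.Empty using (⊥-elim)
open import Function using (_∘_)
open import Relation.Nullary using (¬_; yes; no; Dec)
open import Relation.Nullary.Decidable using (¬?; decidable-stable)
open import Relation.Binary.PropositionalEquality

private
  variable
    n : ℕ

private
  pattern 2≤2+ = +≤+ (N.s≤s (N.s≤s N.z≤n))

+2≤⇒0< : ∀ {i} → + 2 ≤ i → 0ℤ < i
+2≤⇒0< = <-≤-trans (+<+ (N.s≤s N.z≤n))

+2≤⇒2≤∣∣ : ∀ {i} → + 2 ≤ i → 2 N.≤ ∣ i ∣
+2≤⇒2≤∣∣ (+≤+ p) = p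

2≤∣∣⇒+2≤ : ∀ {i} → 2 N.≤ ∣ i ∣ → 0ℤ < i → + 2 ≤ i
2≤∣∣⇒+2≤ {+ _} p _ = +≤+ p

2≤∣∣⇒0<⊎<0 : ∀ {i} → 2 N.≤ ∣ i ∣ → 0ℤ < i ⊎ i < 0ℤ
2≤∣∣⇒0<⊎<0 {+ N.suc _}  _ = inj₁ (+<+ (N.s≤s N.z≤n))
2≤∣∣⇒0<⊎<0 { -[1+ _ ]} _ = inj₂ -<+

2≤∣-∣ : ∀ {i} → 2 N.≤ ∣ i ∣ → 2 N.≤ ∣ - i ∣
2≤∣-∣ {i} = subst (2 N.≤_) (sym (∣-i∣≡∣i∣ i))

i≡-i⇒i≡0 : ∀ {i} → i ≡ - i → i ≡ 0ℤ
i≡-i⇒i≡0 {+ N.zero} _ = refl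

⊔0*⊔0≡0 : ∀ {i j} → i ≤ 0ℤ ⊎ j ≤ 0ℤ → (i ⊔ 0ℤ) * (j ⊔ 0ℤ) ≡ 0ℤ
⊔0*⊔0≡0 (inj₁ i≤0) rewrite i≤j⇒i⊔j≡j i≤0 = refl
⊔0*⊔0≡0 {i} (inj₂ j≤0) rewrite i≤j⇒i⊔j≡j j≤0 = *-zeroʳ (i ⊔ 0ℤ)

0≤* : ∀ {i j} → 0ℤ ≤ i → 0ℤ ≤ j → 0ℤ ≤ i * j
0≤* {+ m} {+ n} _ _ = subst (0ℤ ≤_) (pos-* m n) (+≤+ N.z≤n)

0≤+0≤ : ∀ {i j} → 0ℤ ≤ i → 0ℤ ≤ j → 0ℤ ≤ i + j
0≤+0≤ = +-mono-≤

0≤+ : ∀ m → 0ℤ ≤ + m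
0≤+ _ = +≤+ N.z≤n

≤-by-gap : ∀ {i j} d → 0ℤ ≤ d → j ≡ i + d → i ≤ j
≤-by-gap {i} {j} d 0≤d j≡i+d =
  subst (_≤ j) (+-identityʳ i) (subst (i + 0ℤ ≤_) (sym j≡i+d) (+-monoʳ-≤ i 0≤d))

<-by-gap : ∀ {i j} d → 0ℤ ≤ d → j ≡ + 1 + i + d → i < j
<-by-gap d 0≤d eq = suc[i]≤j⇒i<j (≤-by-gap d 0≤d eq)

cross-bound′ : ∀ {a b c} → + 2 ≤ a → + 2 ≤ b → - c < b → a < c + a * b × b < c + a * b
cross-bound′ {+ N.suc (N.suc x)} {+ N.suc (N.suc y)} {c} 2≤2+ 2≤2+ -c<b =
  <-by-gap _ (0≤+0≤ (0≤+0≤ (0≤+0≤ gap (0≤+ x)) (0≤+ y)) (0≤* (0≤+ x) (0≤+ y))) (eq₁ c (+ x) (+ y)) ,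
  <-by-gap _ (0≤+0≤ (0≤+0≤ (0≤+0≤ gap (0≤+ x)) (0≤+ x)) (0≤* (0≤+ x) (0≤+ y))) (eq₂ c (+ x) (+ y))
  where
  gap : 0ℤ ≤ (+ 2 + + y) - (+ 1 + - c)
  gap = i≤j⇒0≤j-i (i<j⇒suc[i]≤j -c<b)
  eq₁ : ∀ c x y → c + (+ 2 + x) * (+ 2 + y) ≡ + 1 + (+ 2 + x) + ((+ 2 + y - (+ 1 + - c)) + x + y + x * y)
  eq₁ = solve-∀
  eq₂ : ∀ c x y → c + (+ 2 + x) * (+ 2 + y) ≡ + 1 + (+ 2 + y) + ((+ 2 + y - (+ 1 + - c)) + x + x + x * y)
  eq₂ = solve-∀

cross-bound : ∀ {a b c} → + 2 ≤ a → + 2 ≤ b → - c < b ⊎ - c < a →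
  a < c + a * b × b < c + a * b
cross-bound 2≤a 2≤b (inj₁ -c<b) = cross-bound′ 2≤a 2≤b -c<b
cross-bound {a} {b} {c} 2≤a 2≤b (inj₂ -c<a) with cross-bound′ {b} {a} {c} 2≤b 2≤a -c<a
... | b<c+ba , a<c+ba rewrite *-comm b a = a<c+ba , b<c+ba

-- b + c a and - c + (b + c a) a are the entries v → k of μ_k' Q and v → k' of μ_[k',k] Q,
-- where b = q_vk, c = q_vk' and a = q_k'k.
two-step-bound : ∀ {a b c} → + 2 ≤ b → + 2 ≤ c → 0ℤ ≤ a → + 2 ≤ b + c * a × a < b + c * a
two-step-bound {+ a} {+ N.suc (N.suc b)} {+ N.suc (N.suc c)} 2≤2+ 2≤2+ (+≤+ _) =
  ≤-by-gap _ (0≤+0≤ (0≤+ b) (0≤* (0≤+ (N.suc (N.suc c))) (0≤+ a))) (eq₁ (+ a) (+ b) (+ c)) ,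
  <-by-gap _ (0≤+0≤ (0≤+0≤ (0≤+0≤ (0≤+ 1) (0≤+ b)) (0≤+ a)) (0≤* (0≤+ c) (0≤+ a)))
    (eq₂ (+ a) (+ b) (+ c))
  where
  eq₁ : ∀ a b c → (+ 2 + b) + (+ 2 + c) * a ≡ + 2 + (b + (+ 2 + c) * a)
  eq₁ = solve-∀
  eq₂ : ∀ a b c → (+ 2 + b) + (+ 2 + c) * a ≡ + 1 + a + ((+ 1 + b + a) + c * a)
  eq₂ = solve-∀

three-step-bound : ∀ {a b c} → + 2 ≤ b → + 2 ≤ c → 0ℤ < a → + 2 ≤ - c + (b + c * a) * a
three-step-bound {+ N.suc a} {+ N.suc (N.suc b)} {+ N.suc (N.suc c)} 2≤2+ 2≤2+ (+<+ _) =
  ≤-by-gap _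
    (0≤+0≤ (0≤+0≤ (0≤+ b) (0≤* (0≤+ (N.suc (N.suc b))) (0≤+ a)))
           (0≤* (0≤+ (N.suc (N.suc c))) (0≤+0≤ (0≤+0≤ (0≤+ a) (0≤+ a)) (0≤* (0≤+ a) (0≤+ a)))))
    (eq (+ a) (+ b) (+ c))
  where
  eq : ∀ a b c → - (+ 2 + c) + ((+ 2 + b) + (+ 2 + c) * (+ 1 + a)) * (+ 1 + a)
                   ≡ + 2 + (b + (+ 2 + b) * a + (+ 2 + c) * (a + a + a * a))
  eq = solve-∀

module QuiverFacts {Q : Mat n} (sk : IsQuiver Q) where

  antisym : ∀ i j → - Q i j ≡ Q j i
  antisym i j = sym (sk j i)

  diagonal≡0 : ∀ i → Q i i ≡ 0ℤ
  diagonal≡0 i = i≡-i⇒i≡0 (sk i i)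

  ¬0<diagonal : ∀ {i} → ¬ 0ℤ < Q i i
  ¬0<diagonal {i} p = <-irrefl refl (subst (0ℤ <_) (diagonal≡0 i) p)

  0<⇒≢ : ∀ {i j} → 0ℤ < Q i j → i ≢ j
  0<⇒≢ p refl = ¬0<diagonal p

  0<⇒<0 : ∀ {i j} → 0ℤ < Q i j → Q j i < 0ℤ
  0<⇒<0 {i} {j} p = subst (_< 0ℤ) (antisym i j) (neg-mono-< p)

  0≤⇒≤0 : ∀ {i j} → 0ℤ ≤ Q i j → Q j i ≤ 0ℤ
  0≤⇒≤0 {i} {j} p = subst (_≤ 0ℤ) (antisym i j) (neg-mono-≤ p)

  <0⇒0< : ∀ {i j} → Q i j < 0ℤ → 0ℤ < Q j i
  <0⇒0< {i} {j} p = subst (0ℤ <_) (antisym i j) (neg-mono-< p)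

  +2≤⇒¬0< : ∀ {i j} → + 2 ≤ Q i j → ¬ 0ℤ < Q j i
  +2≤⇒¬0< p q = <-asym q (0<⇒<0 (+2≤⇒0< p))

  2≤∣∣-sym : ∀ {i j} → 2 N.≤ ∣ Q i j ∣ → 2 N.≤ ∣ Q j i ∣
  2≤∣∣-sym {i} {j} p = subst (λ z → 2 N.≤ ∣ z ∣) (antisym i j) (2≤∣-∣ {Q i j} p)

  +2≤⇒2≤∣∣ᵒᵖ : ∀ {i j} → + 2 ≤ Q i j → 2 N.≤ ∣ Q j i ∣
  +2≤⇒2≤∣∣ᵒᵖ p = 2≤∣∣-sym (+2≤⇒2≤∣∣ p)

  Qkk'⇒away : ∀ {k k' j} → Qkk' Q k k' j → j ≢ k × j ≢ k'
  Qkk'⇒away (inj₁ (out , in')) = (λ { refl → ¬0<diagonal out }) , (λ { refl → ¬0<diagonal in' })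
  Qkk'⇒away (inj₂ (out , in')) = (λ { refl → ¬0<diagonal in' }) , (λ { refl → ¬0<diagonal out })

NoPathVia : Mat n → Fin n → Fin n → Fin n → Set
NoPathVia Q a v b = Q a v ≤ 0ℤ ⊎ Q v b ≤ 0ℤ

module _ {Q : Mat n} where

  μ-row : ∀ v b → μ v Q v b ≡ - Q v b
  μ-row v b with v ≟ v
  ... | yes _  = refl
  ... | no v≢v = ⊥-elim (v≢v refl)

  μ-col : ∀ v a → μ v Q a v ≡ - Q a v
  μ-col v a with a ≟ v | v ≟ v
  ... | yes _ | _      = refl
  ... | no _  | yes _  = refl
  ... | no _  | no v≢v = ⊥-elim (v≢v refl)

  μ-off : ∀ {v a b} → a ≢ v → b ≢ v →
    μ v Q a b ≡ Q a b + (Q a v ⊔ 0ℤ) * (Q v b ⊔ 0ℤ) - (Q b v ⊔ 0ℤ) * (Q v a ⊔ 0ℤ)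
  μ-off {v} {a} {b} a≢v b≢v with a ≟ v | b ≟ v
  ... | yes a≡v | _       = ⊥-elim (a≢v a≡v)
  ... | no _    | yes b≡v = ⊥-elim (b≢v b≡v)
  ... | no _    | no _    = refl

  μ-unchanged : ∀ {v a b} → a ≢ v → b ≢ v → NoPathVia Q a v b → NoPathVia Q b v a → μ v Q a b ≡ Q a b
  μ-unchanged {v} {a} {b} a≢v b≢v no-ab no-ba = begin
    μ v Q a b           ≡⟨ μ-off a≢v b≢v ⟩
    Q a b + P₁ - P₂     ≡⟨ cong₂ (λ p q → Q a b + p - q) (⊔0*⊔0≡0 no-ab) (⊔0*⊔0≡0 no-ba) ⟩
    Q a b + 0ℤ + 0ℤ     ≡⟨ trans (+-identityʳ _) (+-identityʳ _) ⟩
    Q a b               ∎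
    where
    open ≡-Reasoning
    P₁ = (Q a v ⊔ 0ℤ) * (Q v b ⊔ 0ℤ)
    P₂ = (Q b v ⊔ 0ℤ) * (Q v a ⊔ 0ℤ)

  μ-through : IsQuiver Q → ∀ {v a b} → a ≢ v → b ≢ v → 0ℤ ≤ Q a v → 0ℤ ≤ Q v b →
    μ v Q a b ≡ Q a b + Q a v * Q v b
  μ-through sk {v} {a} {b} a≢v b≢v 0≤av 0≤vb = begin
    μ v Q a b                    ≡⟨ μ-off a≢v b≢v ⟩
    Q a b + P₁ - P₂              ≡⟨ cong₂ (λ p q → Q a b + p - q) P₁≡ P₂≡0 ⟩
    Q a b + Q a v * Q v b + 0ℤ   ≡⟨ +-identityʳ _ ⟩
    Q a b + Q a v * Q v b        ∎
    where
    open ≡-Reasoning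
    P₁ = (Q a v ⊔ 0ℤ) * (Q v b ⊔ 0ℤ)
    P₂ = (Q b v ⊔ 0ℤ) * (Q v a ⊔ 0ℤ)
    P₁≡ : P₁ ≡ Q a v * Q v b
    P₁≡ = cong₂ _*_ (i≥j⇒i⊔j≡i 0≤av) (i≥j⇒i⊔j≡i 0≤vb)
    P₂≡0 : P₂ ≡ 0ℤ
    P₂≡0 = ⊔0*⊔0≡0 (inj₁ (QuiverFacts.0≤⇒≤0 sk 0≤vb))

  μ-isQuiver : IsQuiver Q → ∀ v → IsQuiver (μ v Q)
  μ-isQuiver sk v a b = by-cases (a ≟ v) (b ≟ v)
    where
    by-cases : Dec (a ≡ v) → Dec (b ≡ v) → μ v Q a b ≡ - μ v Q b a
    by-cases (yes refl) _        = trans (μ-row a b) (trans (cong -_ (sk a b)) (cong -_ (sym (μ-col a b))))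
    by-cases (no _)     (yes refl) = trans (μ-col b a) (trans (cong -_ (sk a b)) (cong -_ (sym (μ-row b a))))
    by-cases (no a≢v)   (no b≢v) = begin
      μ v Q a b             ≡⟨ μ-off a≢v b≢v ⟩
      Q a b + P₁ - P₂       ≡⟨ cong (λ q → q + P₁ - P₂) (sk a b) ⟩
      - Q b a + P₁ - P₂     ≡⟨ negate (Q b a) P₁ P₂ ⟩
      - (Q b a + P₂ - P₁)   ≡⟨ cong -_ (sym (μ-off b≢v a≢v)) ⟩
      - μ v Q b a           ∎
      where
      open ≡-Reasoning
      P₁ = (Q a v ⊔ 0ℤ) * (Q v b ⊔ 0ℤ)
      P₂ = (Q b v ⊔ 0ℤ) * (Q v a ⊔ 0ℤ)
      negate : ∀ q p₁ p₂ → - q + p₁ - p₂ ≡ - (q + p₂ - p₁)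
      negate = solve-∀

module _ {X : Mat n} {S : Fin n → Set} where

  cycle-vertex : (c : DirectedCycleIn X S) → ∀ {u} → u N.≤ proj₁ c → S (proj₁ (proj₂ c) u)
  cycle-vertex (ℓ , v , 1≤ℓ , closed , steps) {u} u≤ℓ with NP.m≤n⇒m<n∨m≡n u≤ℓ
  ... | inj₁ u<ℓ  = proj₁ (steps u u<ℓ)
  ... | inj₂ refl = subst S (sym closed) (proj₁ (steps 0 1≤ℓ))

  triangle : ∀ {a b c} → S a → S b → S c → 0ℤ < X a b → 0ℤ < X b c → 0ℤ < X c a → DirectedCycleIn X S
  triangle {a} {b} {c} sa sb sc ab bc ca = 3 , walk , N.s≤s N.z≤n , refl , steps
    where
    walk : ℕ → Fin n
    walk 1 = b
    walk 2 = c
    walk _ = a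
    steps : ∀ t → N.suc t N.≤ 3 → S (walk t) × 0ℤ < X (walk t) (walk (N.suc t))
    steps 0 _ = sa , ab
    steps 1 _ = sb , bc
    steps 2 _ = sc , ca
    steps (N.suc (N.suc (N.suc _))) (N.s≤s (N.s≤s (N.s≤s ())))

  AcyclicOn⇒0≤chord : IsQuiver X → AcyclicOn X S → ∀ {a r b} → S a → S r → S b →
    0ℤ < X a r → 0ℤ < X r b → 0ℤ ≤ X a b
  AcyclicOn⇒0≤chord sk ac {a} {r} {b} sa sr sb ar rb with 0ℤ ≤? X a b
  ... | yes 0≤ab = 0≤ab
  ... | no  0≰ab = ⊥-elim (ac (triangle sa sr sb ar rb (QuiverFacts.<0⇒0< sk (≰⇒> 0≰ab))))

  AcyclicOn-source : ∀ s → (∀ {a} → S a → ¬ 0ℤ < X a s) → AcyclicOn X (λ a → S a × a ≢ s) → AcyclicOn X S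
  AcyclicOn-source s no-entry ac (N.zero , _ , () , _)
  AcyclicOn-source s no-entry ac (N.suc ℓ , v , 1≤ℓ , closed , steps) =
    ac (N.suc ℓ , v , 1≤ℓ , closed , λ t t<ℓ → (proj₁ (steps t t<ℓ) , ≢s t t<ℓ) , proj₂ (steps t t<ℓ))
    where
    entered : ∀ t → N.suc t N.≤ N.suc ℓ → v (N.suc t) ≢ s
    entered t t<ℓ refl = no-entry (proj₁ (steps t t<ℓ)) (proj₂ (steps t t<ℓ))
    ≢s : ∀ t → N.suc t N.≤ N.suc ℓ → v t ≢ s
    ≢s N.zero    _   v₀≡s = entered ℓ NP.≤-refl (trans closed v₀≡s)
    ≢s (N.suc t) t<ℓ      = entered t (NP.<⇒≤ t<ℓ)

  AcyclicOn-sink : ∀ s → (∀ {b} → S b → ¬ 0ℤ < X s b) → AcyclicOn X (λ a → S a × a ≢ s) → AcyclicOn X S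
  AcyclicOn-sink s no-exit ac c@(ℓ , v , 1≤ℓ , closed , steps) =
    ac (ℓ , v , 1≤ℓ , closed , λ t t<ℓ → (proj₁ (steps t t<ℓ) , ≢s t t<ℓ) , proj₂ (steps t t<ℓ))
    where
    ≢s : ∀ t → N.suc t N.≤ ℓ → v t ≢ s
    ≢s t t<ℓ refl = no-exit (cycle-vertex c t<ℓ) (proj₂ (steps t t<ℓ))

¬Acyclic-triangle : ∀ {X : Mat n} {a b c} → 0ℤ < X a b → 0ℤ < X b c → 0ℤ < X c a → ¬ Acyclic X
¬Acyclic-triangle {X = X} ab bc ca ac = ac (triangle {X = X} tt tt tt ab bc ca)

DirectedCycleIn-map : ∀ {X Y : Mat n} {S T : Fin n → Set} →
  (∀ {a b} → S a → S b → 0ℤ < X a b → T a × 0ℤ < Y a b) → DirectedCycleIn X S → DirectedCycleIn Y T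
DirectedCycleIn-map {X = X} {S = S} f c@(ℓ , v , 1≤ℓ , closed , steps) =
  ℓ , v , 1≤ℓ , closed ,
  λ t t<ℓ → f (proj₁ (steps t t<ℓ)) (cycle-vertex {X = X} {S = S} c t<ℓ) (proj₂ (steps t t<ℓ))

DirectedCycleIn-reverse : ∀ {X Y : Mat n} {S : Fin n → Set} →
  (∀ {a b} → S a → S b → 0ℤ < X a b → 0ℤ < Y b a) → DirectedCycleIn X S → DirectedCycleIn Y S
DirectedCycleIn-reverse {X = X} {Y = Y} {S = S} f c@(ℓ , v , 1≤ℓ , closed , steps) =
  ℓ , (λ t → v (ℓ N.∸ t)) , 1≤ℓ , trans (cong v (NP.n∸n≡0 ℓ)) (sym closed) , reversed
  where
  vertex = cycle-vertex {X = X} {S = S} c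
  reversed : ∀ t → N.suc t N.≤ ℓ → S (v (ℓ N.∸ t)) × 0ℤ < Y (v (ℓ N.∸ t)) (v (ℓ N.∸ N.suc t))
  reversed t t<ℓ = vertex (NP.m∸n≤m ℓ t) , subst (λ u → 0ℤ < Y (v u) (v (ℓ N.∸ N.suc t))) back
    (f (proj₁ (steps (ℓ N.∸ N.suc t) earlier)) (vertex earlier) (proj₂ (steps (ℓ N.∸ N.suc t) earlier)))
    where
    back : N.suc (ℓ N.∸ N.suc t) ≡ ℓ N.∸ t
    back = sym (NP.+-∸-assoc 1 t<ℓ)
    earlier : N.suc (ℓ N.∸ N.suc t) N.≤ ℓ
    earlier = subst (N._≤ ℓ) (sym back) (NP.m∸n≤m ℓ t)

AcyclicOn-transfer : ∀ {X Y : Mat n} {S T : Fin n → Set} → (∀ {a} → S a → T a) →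
  (∀ {a b} → S a → S b → X a b ≡ Y a b) → AcyclicOn Y T → AcyclicOn X S
AcyclicOn-transfer {X = X} {Y} {S} {T} S⊆T X≡Y ac c =
  ac (DirectedCycleIn-map {X = X} {Y} {S} {T} (λ {a} {b} sa sb p → S⊆T sa , subst (0ℤ <_) (X≡Y {a} {b} sa sb) p) c)

AbundantOn-transfer : ∀ {X Y : Mat n} {S T : Fin n → Set} → (∀ {a} → S a → T a) →
  (∀ {a b} → S a → S b → X a b ≡ Y a b) → AbundantOn Y T → AbundantOn X S
AbundantOn-transfer S⊆T X≡Y ab a b sa sb a≢b =
  subst (λ z → 2 N.≤ ∣ z ∣) (sym (X≡Y sa sb)) (ab a b (S⊆T sa) (S⊆T sb) a≢b)

-- The fork criterion

SameSide : Mat n → Fin n → Fin n → Fin n → Set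
SameSide R r x y = (In R r x × In R r y) ⊎ (Out R r x × Out R r y)

record ForkingVertex (R : Mat n) (r : Fin n) : Set where
  field
    abundant-at     : ∀ x → x ≢ r → 2 N.≤ ∣ R x r ∣
    abundant-beside : ∀ x y → x ≢ y → SameSide R r x y → 2 N.≤ ∣ R x y ∣
    return-bound    : ∀ {x y} → In R r x → Out R r y → - R x y < R r y ⊎ - R x y < R x r
    acyclic-in      : AcyclicOn R (In R r)
    acyclic-out     : AcyclicOn R (Out R r)
    passage         : ∃₂ λ x y → In R r x × Out R r y

module ForkCriterion {R : Mat n} {r : Fin n} (sk : IsQuiver R) (fv : ForkingVertex R r) where
  open ForkingVertex fv
  open QuiverFacts sk

  F : Mat n
  F = μ r R

  module F-facts = QuiverFacts (μ-isQuiver sk r)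

  in≢r : ∀ {x} → In R r x → x ≢ r
  in≢r = 0<⇒≢

  out≢r : ∀ {y} → Out R r y → y ≢ r
  out≢r y-out = ≢-sym (0<⇒≢ y-out)

  in⇒+2≤ : ∀ {x} → In R r x → + 2 ≤ R x r
  in⇒+2≤ {x} x-in = 2≤∣∣⇒+2≤ (abundant-at x (in≢r x-in)) x-in

  out⇒+2≤ : ∀ {y} → Out R r y → + 2 ≤ R r y
  out⇒+2≤ {y} y-out = 2≤∣∣⇒+2≤ (2≤∣∣-sym (abundant-at y (out≢r y-out))) y-out

  side : ∀ {x} → x ≢ r → In R r x ⊎ Out R r x
  side {x} x≢r with 2≤∣∣⇒0<⊎<0 (abundant-at x x≢r)
  ... | inj₁ x-in  = inj₁ x-in
  ... | inj₂ xr<0  = inj₂ (<0⇒0< xr<0)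

  F-from-r : ∀ j → F r j ≡ R j r
  F-from-r j = trans (μ-row r j) (antisym r j)

  F-into-r : ∀ i → F i r ≡ R r i
  F-into-r i = trans (μ-col r i) (antisym i r)

  F-beside : ∀ {x y} → SameSide R r x y → F x y ≡ R x y
  F-beside (inj₁ (x-in , y-in)) =
    μ-unchanged (in≢r x-in) (in≢r y-in) (inj₂ (<⇒≤ (0<⇒<0 y-in))) (inj₂ (<⇒≤ (0<⇒<0 x-in)))
  F-beside (inj₂ (x-out , y-out)) =
    μ-unchanged (out≢r x-out) (out≢r y-out) (inj₁ (<⇒≤ (0<⇒<0 x-out))) (inj₁ (<⇒≤ (0<⇒<0 y-out)))

  F-across : ∀ {x y} → In R r x → Out R r y → F x y ≡ R x y + R x r * R r y
  F-across x-in y-out = μ-through sk (in≢r x-in) (out≢r y-out) (<⇒≤ x-in) (<⇒≤ y-out)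

  across-bound : ∀ {x y} → In R r x → Out R r y → R x r < F x y × R r y < F x y
  across-bound x-in y-out rewrite F-across x-in y-out =
    cross-bound (in⇒+2≤ x-in) (out⇒+2≤ y-out) (return-bound x-in y-out)

  across-+2≤ : ∀ {x y} → In R r x → Out R r y → + 2 ≤ F x y
  across-+2≤ x-in y-out = ≤-trans (in⇒+2≤ x-in) (<⇒≤ (proj₁ (across-bound x-in y-out)))

  abundant : Abundant F
  abundant i j _ _ i≢j = by-cases (i ≟ r) (j ≟ r)
    where
    by-cases : Dec (i ≡ r) → Dec (j ≡ r) → 2 N.≤ ∣ F i j ∣
    by-cases (yes refl) _ =
      subst (λ z → 2 N.≤ ∣ z ∣) (sym (F-from-r j)) (abundant-at j (≢-sym i≢j))
    by-cases (no _) (yes refl) =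
      subst (λ z → 2 N.≤ ∣ z ∣) (sym (F-into-r i)) (2≤∣∣-sym (abundant-at i i≢j))
    by-cases (no i≢r) (no j≢r) with side i≢r | side j≢r
    ... | inj₁ i-in  | inj₁ j-in  = subst (λ z → 2 N.≤ ∣ z ∣) (sym (F-beside (inj₁ (i-in , j-in))))
                                          (abundant-beside i j i≢j (inj₁ (i-in , j-in)))
    ... | inj₂ i-out | inj₂ j-out = subst (λ z → 2 N.≤ ∣ z ∣) (sym (F-beside (inj₂ (i-out , j-out))))
                                          (abundant-beside i j i≢j (inj₂ (i-out , j-out)))
    ... | inj₁ i-in  | inj₂ j-out = +2≤⇒2≤∣∣ (across-+2≤ i-in j-out)
    ... | inj₂ i-out | inj₁ j-in  = F-facts.+2≤⇒2≤∣∣ᵒᵖ {j} {i} (across-+2≤ j-in i-out)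

  ¬acyclic : ¬ Acyclic F
  ¬acyclic with passage
  ... | x , y , x-in , y-out = ¬Acyclic-triangle {X = F} {r} {x} {y}
    (subst (0ℤ <_) (sym (F-from-r x)) x-in)
    (<-trans x-in (proj₁ (across-bound x-in y-out)))
    (subst (0ℤ <_) (sym (F-into-r y)) y-out)

  inF⇒out : ∀ {i} → In F r i → Out R r i
  inF⇒out {i} = subst (0ℤ <_) (F-into-r i)

  outF⇒in : ∀ {j} → Out F r j → In R r j
  outF⇒in {j} = subst (0ℤ <_) (F-from-r j)

  return-inequalities : ∀ i j → In F r i → Out F r j → F i r < F j i × F r j < F j i
  return-inequalities i j i-in j-out with across-bound (outF⇒in j-out) (inF⇒out i-in)
  ... | jr<F , ri<F = subst (_< F j i) (sym (F-into-r i)) ri<F , subst (_< F j i) (sym (F-from-r j)) jr<F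

  acyclic-inF : AcyclicOn F (In F r)
  acyclic-inF = AcyclicOn-transfer {X = F} {R} {In F r} {Out R r} inF⇒out
    (λ {a} {b} a-in b-in → F-beside {a} {b} (inj₂ (inF⇒out a-in , inF⇒out b-in))) acyclic-out

  acyclic-outF : AcyclicOn F (Out F r)
  acyclic-outF = AcyclicOn-transfer {X = F} {R} {Out F r} {In R r} outF⇒in
    (λ {a} {b} a-out b-out → F-beside {a} {b} (inj₁ (outF⇒in a-out , outF⇒in b-out))) acyclic-in

  isFork : IsFork F r
  isFork = abundant , ¬acyclic , return-inequalities , acyclic-inF , acyclic-outF

Away : Fin n → Fin n → Fin n → Set
Away x y v = v ≢ x × v ≢ y

locate : (x y v : Fin n) → v ≡ x ⊎ v ≡ y ⊎ Away x y v
locate x y v with v ≟ x | v ≟ y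
... | yes v≡x | _       = inj₁ v≡x
... | no _    | yes v≡y = inj₂ (inj₁ v≡y)
... | no v≢x  | no v≢y  = inj₂ (inj₂ (v≢x , v≢y))

-- x ⇉ v ⇉ y for every other vertex v; for a key with sink k, μ_k, μ_k' and μ_[k',k] produce this shape.
record Transit (X : Mat n) (x y : Fin n) : Set where
  field
    abundant-away : AbundantOn X (Away x y)
    acyclic-away  : AcyclicOn X (Away x y)
    enter         : ∀ {v} → Away x y v → + 2 ≤ X x v
    leave         : ∀ {v} → Away x y v → + 2 ≤ X v y
    return-bound  : ∀ {v} → Away x y v → - X x y < X v y ⊎ - X x y < X x v

module TransitFacts {X : Mat n} {x y : Fin n} (sk : IsQuiver X) (tr : Transit X x y) where
  open Transit tr
  open QuiverFacts sk

  no-entry-to-x : ∀ {v} → v ≢ y → ¬ 0ℤ < X v x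
  no-entry-to-x {v} v≢y with locate x y v
  ... | inj₁ refl          = ¬0<diagonal
  ... | inj₂ (inj₁ v≡y)    = ⊥-elim (v≢y v≡y)
  ... | inj₂ (inj₂ v-away) = +2≤⇒¬0< (enter v-away)

  no-exit-from-y : ∀ {v} → v ≢ x → ¬ 0ℤ < X y v
  no-exit-from-y {v} v≢x with locate x y v
  ... | inj₁ v≡x           = ⊥-elim (v≢x v≡x)
  ... | inj₂ (inj₁ refl)   = ¬0<diagonal
  ... | inj₂ (inj₂ v-away) = +2≤⇒¬0< (leave v-away)

  acyclicOn-avoiding-y : ∀ {S : Fin n → Set} → (∀ {v} → S v → v ≢ y) → AcyclicOn X S
  acyclicOn-avoiding-y {S} S≢y = AcyclicOn-source {X = X} {S} x (λ sv → no-entry-to-x (S≢y sv))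
    (AcyclicOn-transfer {X = X} {X} {λ v → S v × v ≢ x} {Away x y}
       (λ (sv , v≢x) → v≢x , S≢y sv) (λ _ _ → refl) acyclic-away)

  acyclicOn-avoiding-x : ∀ {S : Fin n → Set} → (∀ {v} → S v → v ≢ x) → AcyclicOn X S
  acyclicOn-avoiding-x {S} S≢x = AcyclicOn-sink {X = X} {S} y (λ sv → no-exit-from-y (S≢x sv))
    (AcyclicOn-transfer {X = X} {X} {λ v → S v × v ≢ y} {Away x y}
       (λ (sv , v≢y) → S≢x sv , v≢y) (λ _ _ → refl) acyclic-away)

  acyclic : 0ℤ ≤ X x y → Acyclic X
  acyclic 0≤xy = AcyclicOn-sink {X = X} {Everything} y y-sink (acyclicOn-avoiding-y proj₂)
    where
    y-sink : ∀ {v} → Everything v → ¬ 0ℤ < X y v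
    y-sink {v} _ with v ≟ x
    ... | yes refl = ≤⇒≯ (0≤⇒≤0 0≤xy)
    ... | no v≢x   = no-exit-from-y v≢x

  ¬acyclic : X x y < 0ℤ → ∀ {v} → Away x y v → ¬ Acyclic X
  ¬acyclic xy<0 {v} v-away =
    ¬Acyclic-triangle {X = X} {x} {v} {y} (+2≤⇒0< (enter v-away)) (+2≤⇒0< (leave v-away)) (<0⇒0< xy<0)

  keySetFull : KeySetFull X x y
  keySetFull j = Qkk'⇒away , λ j-away → inj₁ (+2≤⇒0< (enter j-away) , +2≤⇒0< (leave j-away))

  module _ {r} (r-away : Away x y r) where

    x-in : In X r x
    x-in = +2≤⇒0< (enter r-away)

    y-out : Out X r y
    y-out = +2≤⇒0< (leave r-away)

    ¬x-out : ¬ Out X r x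
    ¬x-out = +2≤⇒¬0< (enter r-away)

    ¬y-in : ¬ In X r y
    ¬y-in = +2≤⇒¬0< (leave r-away)

    abundant-at : ∀ v → v ≢ r → 2 N.≤ ∣ X v r ∣
    abundant-at v v≢r with locate x y v
    ... | inj₁ refl          = +2≤⇒2≤∣∣ (enter r-away)
    ... | inj₂ (inj₁ refl)   = +2≤⇒2≤∣∣ᵒᵖ (leave r-away)
    ... | inj₂ (inj₂ v-away) = abundant-away v r v-away r-away v≢r

    abundant-beside : ∀ a b → a ≢ b → SameSide X r a b → 2 N.≤ ∣ X a b ∣
    abundant-beside a b a≢b same with locate x y a | locate x y b
    ... | inj₁ refl          | inj₁ refl          = ⊥-elim (a≢b refl)
    ... | inj₂ (inj₁ refl)   | inj₂ (inj₁ refl)   = ⊥-elim (a≢b refl)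
    ... | inj₁ refl          | inj₂ (inj₁ refl)   = ⊥-elim ([ ¬y-in ∘ proj₂ , ¬x-out ∘ proj₁ ]′ same)
    ... | inj₂ (inj₁ refl)   | inj₁ refl          = ⊥-elim ([ ¬y-in ∘ proj₁ , ¬x-out ∘ proj₂ ]′ same)
    ... | inj₁ refl          | inj₂ (inj₂ b-away) = +2≤⇒2≤∣∣ (enter b-away)
    ... | inj₂ (inj₁ refl)   | inj₂ (inj₂ b-away) = +2≤⇒2≤∣∣ᵒᵖ (leave b-away)
    ... | inj₂ (inj₂ a-away) | inj₁ refl          = +2≤⇒2≤∣∣ᵒᵖ (enter a-away)
    ... | inj₂ (inj₂ a-away) | inj₂ (inj₁ refl)   = +2≤⇒2≤∣∣ (leave a-away)
    ... | inj₂ (inj₂ a-away) | inj₂ (inj₂ b-away) = abundant-away a b a-away b-away a≢b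

    nonneg-return-bound : ∀ {a b} → 0ℤ ≤ X a b → Out X r b → - X a b < X r b ⊎ - X a b < X a r
    nonneg-return-bound 0≤ab b-out = inj₁ (≤-<-trans (neg-mono-≤ 0≤ab) b-out)

    return-bound-at : ∀ {a b} → In X r a → Out X r b → - X a b < X r b ⊎ - X a b < X a r
    return-bound-at {a} {b} a-in b-out with locate x y a | locate x y b
    ... | inj₂ (inj₁ refl)   | _                  = ⊥-elim (¬y-in a-in)
    ... | _                  | inj₁ refl          = ⊥-elim (¬x-out b-out)
    ... | inj₁ refl          | inj₂ (inj₁ refl)   = return-bound r-away
    ... | inj₁ refl          | inj₂ (inj₂ b-away) = nonneg-return-bound (<⇒≤ (+2≤⇒0< (enter b-away))) b-out
    ... | inj₂ (inj₂ a-away) | inj₂ (inj₁ refl)   = nonneg-return-bound (<⇒≤ (+2≤⇒0< (leave a-away))) b-out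
    ... | inj₂ (inj₂ a-away) | inj₂ (inj₂ b-away) =
      nonneg-return-bound (AcyclicOn⇒0≤chord sk acyclic-away a-away r-away b-away a-in b-out) b-out

    forkingVertex : ForkingVertex X r
    forkingVertex = record
      { abundant-at     = abundant-at
      ; abundant-beside = abundant-beside
      ; return-bound    = return-bound-at
      ; acyclic-in      = acyclicOn-avoiding-y λ { v-in refl → ¬y-in v-in }
      ; acyclic-out     = acyclicOn-avoiding-x λ { v-out refl → ¬x-out v-out }
      ; passage         = x , y , x-in , y-out
      }

  forksAway : ForksAway X x y
  forksAway r r≢x r≢y = ForkCriterion.isFork sk (forkingVertex (r≢x , r≢y))

ForkingPair : Mat n → Mat n → Fin n → Fin n → Set
ForkingPair X Q k k' = KeySetFull X k k' × ForksAway X k k' × AgreesAway X Q k k'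

KeySetFull-swap : ∀ {X : Mat n} {k k'} → KeySetFull X k' k → KeySetFull X k k'
KeySetFull-swap full j =
  Product.swap ∘ proj₁ (full j) ∘ Sum.swap , Sum.swap ∘ proj₂ (full j) ∘ Product.swap

forkingPair : ∀ {X Q : Mat n} {k k'} → IsQuiver X → Transit X k k' ⊎ Transit X k' k →
  AgreesAway X Q k k' → ForkingPair X Q k k'
forkingPair sk (inj₁ tr) agrees = keySetFull , forksAway , agrees
  where open TransitFacts sk tr
forkingPair sk (inj₂ tr) agrees = KeySetFull-swap keySetFull , (λ r r≢k r≢k' → forksAway r r≢k' r≢k) , agrees
  where open TransitFacts sk tr

module _ {X : Mat n} (sk : IsQuiver X) where
  open QuiverFacts sk

  adjoin-source : ∀ {s s'} → AbundantOn X (Away s s') → AcyclicOn X (Away s s') →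
    (∀ {v} → Away s s' v → + 2 ≤ X s' v) → AbundantOn X (Not s) × AcyclicOn X (Not s)
  adjoin-source {s} {s'} abundant-away acyclic-away out =
    abundant , AcyclicOn-source {X = X} {Not s} s' no-entry acyclic-away
    where
    abundant : AbundantOn X (Not s)
    abundant a b a≢s b≢s a≢b with a ≟ s' | b ≟ s'
    ... | yes refl | yes refl = ⊥-elim (a≢b refl)
    ... | yes refl | no b≢s'  = +2≤⇒2≤∣∣ (out (b≢s , b≢s'))
    ... | no a≢s'  | yes refl = +2≤⇒2≤∣∣ᵒᵖ (out (a≢s , a≢s'))
    ... | no a≢s'  | no b≢s'  = abundant-away a b (a≢s , a≢s') (b≢s , b≢s') a≢b
    no-entry : ∀ {a} → Not s a → ¬ 0ℤ < X a s'
    no-entry {a} a≢s with a ≟ s'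
    ... | yes refl = ¬0<diagonal
    ... | no a≢s'  = +2≤⇒¬0< (out (a≢s , a≢s'))

  isKey-of-sources : ∀ {k k'} → k ≢ k' → AbundantOn X (Away k k') → AcyclicOn X (Away k k') →
    (∀ {v} → Away k k' v → + 2 ≤ X k v × + 2 ≤ X k' v) → IsKey X k k'
  isKey-of-sources {k} {k'} k≢k' abundant-away acyclic-away out =
    k≢k' , proj₁ without-k , proj₂ without-k , proj₁ without-k' , proj₂ without-k' ,
    λ i i≢k i≢k' → inj₁ (Product.map +2≤⇒0< +2≤⇒0< (out (i≢k , i≢k')))
    where
    without-k : AbundantOn X (Not k) × AcyclicOn X (Not k)
    without-k = adjoin-source abundant-away acyclic-away (proj₂ ∘ out)
    without-k' : AbundantOn X (Not k') × AcyclicOn X (Not k')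
    without-k' = adjoin-source
      (AbundantOn-transfer {X = X} {X} Product.swap (λ _ _ → refl) abundant-away)
      (AcyclicOn-transfer {X = X} {X} {Away k' k} {Away k k'} Product.swap (λ _ _ → refl) acyclic-away)
      (proj₁ ∘ out ∘ Product.swap)

transpose : Mat n → Mat n
transpose Q i j = Q j i

Transposed : Mat n → Mat n → Set
Transposed X Y = ∀ i j → Y i j ≡ X j i

μ-transposed : ∀ {X Y : Mat n} → Transposed X Y → ∀ v → Transposed (μ v X) (μ v Y)
μ-transposed {X = X} {Y} T v a b = by-cases (a ≟ v) (b ≟ v)
  where
  by-cases : Dec (a ≡ v) → Dec (b ≡ v) → μ v Y a b ≡ μ v X b a
  by-cases (yes refl) _          = trans (μ-row a b) (trans (cong -_ (T a b)) (sym (μ-col a b)))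
  by-cases (no _)     (yes refl) = trans (μ-col b a) (trans (cong -_ (T a b)) (sym (μ-row b a)))
  by-cases (no a≢v)   (no b≢v)
    rewrite μ-off {Q = Y} a≢v b≢v | μ-off {Q = X} b≢v a≢v | T a b | T a v | T v b | T b v | T v a
    = cong₂ (λ p q → X b a + p - q)
        (*-comm (X v a ⊔ 0ℤ) (X b v ⊔ 0ℤ)) (*-comm (X v b ⊔ 0ℤ) (X a v ⊔ 0ℤ))

module Transposition {X Y : Mat n} (T : Transposed X Y) where

  0<-flip : ∀ {a b} → 0ℤ < X a b → 0ℤ < Y b a
  0<-flip {a} {b} = subst (0ℤ <_) (sym (T b a))

  0<-unflip : ∀ {a b} → 0ℤ < Y a b → 0ℤ < X b a
  0<-unflip {a} {b} = subst (0ℤ <_) (T a b)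

  isQuiver : IsQuiver X → IsQuiver Y
  isQuiver sk i j = trans (T i j) (trans (sk j i) (cong -_ (sym (T j i))))

  abundantOn : ∀ {S} → AbundantOn X S → AbundantOn Y S
  abundantOn ab a b sa sb a≢b = subst (λ z → 2 N.≤ ∣ z ∣) (sym (T a b)) (ab b a sb sa (≢-sym a≢b))

  acyclicOn : ∀ {S S'} → (∀ {a} → S a → S' a) → AcyclicOn X S' → AcyclicOn Y S
  acyclicOn {S} {S'} S⊆S' ac c =
    AcyclicOn-transfer {X = X} {X} {S} {S'} S⊆S' (λ _ _ → refl) ac
      (DirectedCycleIn-reverse {X = Y} {X} {S} (λ _ _ → 0<-unflip) c)

  ¬acyclic : ¬ Acyclic X → ¬ Acyclic Y
  ¬acyclic ¬ac ac = ¬ac λ c → ac (DirectedCycleIn-reverse {X = X} {Y} {Everything} (λ _ _ → 0<-flip) c)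

  keySetFull : IsQuiver Y → ∀ {k k'} → KeySetFull X k k' → KeySetFull Y k k'
  keySetFull skY full j = QuiverFacts.Qkk'⇒away skY , λ j-away → flip-sides (proj₂ (full j) j-away)
    where
    flip-sides : ∀ {k k'} → Qkk' X k k' j → Qkk' Y k k' j
    flip-sides (inj₁ (out , in')) = inj₂ (0<-flip in' , 0<-flip out)
    flip-sides (inj₂ (out , in')) = inj₁ (0<-flip in' , 0<-flip out)

  isKey : ∀ {k k'} → IsKey X k k' → IsKey Y k k'
  isKey {k} {k'} (k≢k' , ab , ac , ab' , ac' , sides) =
    k≢k' , abundantOn ab , acyclicOn {Not k} (λ z → z) ac , abundantOn ab' , acyclicOn {Not k'} (λ z → z) ac' ,
    λ i i≢k i≢k' → flip-sides (sides i i≢k i≢k')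
    where
    flip-sides : ∀ {k k' i} → (Out X k i × Out X k' i) ⊎ (In X k i × In X k' i) →
      (Out Y k i × Out Y k' i) ⊎ (In Y k i × In Y k' i)
    flip-sides (inj₁ (p , q)) = inj₂ (0<-flip p , 0<-flip q)
    flip-sides (inj₂ (p , q)) = inj₁ (0<-flip p , 0<-flip q)

  isFork : ∀ {r} → IsFork X r → IsFork Y r
  isFork {r} (ab , ¬ac , bounds , ac-in , ac-out) =
    abundantOn ab , ¬acyclic ¬ac , bounds' ,
    acyclicOn {In Y r} {Out X r} 0<-unflip ac-out , acyclicOn {Out Y r} {In X r} 0<-unflip ac-in
    where
    bounds' : ∀ i j → In Y r i → Out Y r j → Y i r < Y j i × Y r j < Y j i
    bounds' i j i-in j-out with bounds j i (0<-unflip j-out) (0<-unflip i-in)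
    ... | jr<ij , ri<ij = subst₂ _<_ (sym (T i r)) (sym (T j i)) ri<ij , subst₂ _<_ (sym (T r j)) (sym (T j i)) jr<ij

  agreesAway : ∀ {Q Q' : Mat n} {k k'} → Transposed Q' Q → AgreesAway X Q' k k' → AgreesAway Y Q k k'
  agreesAway TQ agrees i j i≢k i≢k' j≢k j≢k' =
    trans (T i j) (trans (agrees j i j≢k j≢k' i≢k i≢k') (sym (TQ i j)))

forksAway-transposed : ∀ {X Y : Mat n} {k k'} → Transposed X Y → ForksAway X k k' → ForksAway Y k k'
forksAway-transposed T forks r r≢k r≢k' = Transposition.isFork (μ-transposed T r) (forks r r≢k r≢k')

-- The four mutations of a key

ReflectedKey : Mat n → Mat n → Fin n → Fin n → Set
ReflectedKey {n} P Q k k' =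
  IsKey P k k' ×
  (∀ (i : Fin n) → i ≢ k → i ≢ k' → (P i k ≡ - Q i k) × (P i k' ≡ - Q i k')) ×
  (P k k' ≡ Q k k') × AgreesAway P Q k k'

KeyMutationFacts : Mat n → Fin n → Fin n → Set
KeyMutationFacts Q k k' =
  (IsQuiver (μ k Q) × Acyclic (μ k Q) × ForkingPair (μ k Q) Q k k') ×
  (IsQuiver (μ[ k , k' ] Q) × ReflectedKey (μ[ k , k' ] Q) Q k k') ×
  (¬ (Sink Q k' ⊎ Source Q k') → IsQuiver (μ k' Q) × ¬ Acyclic (μ k' Q) × ForkingPair (μ k' Q) Q k k') ×
  (¬ (Sink Q k' ⊎ Source Q k') →
    IsQuiver (μ[ k' , k ] Q) × ¬ Acyclic (μ[ k' , k ] Q) × ForkingPair (μ[ k' , k ] Q) Q k k')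

∃-positive : (f : Fin n → ℤ) → ¬ (∀ j → ¬ 0ℤ < f j) → ∃ λ j → 0ℤ < f j
∃-positive {n} f not-all with ¬∀⟶∃¬ n (λ j → ¬ 0ℤ < f j) (λ j → ¬? (0ℤ <? f j)) not-all
... | j , ¬¬pos = j , decidable-stable (0ℤ <? f j) ¬¬pos

module SinkKey {Q : Mat n} {k k' : Fin n} (sk : IsQuiver Q) (key : IsKey Q k k') (sink : Sink Q k) where
  open QuiverFacts sk

  k≢k' : k ≢ k'
  k≢k' = proj₁ key

  k'≢k : k' ≢ k
  k'≢k = ≢-sym k≢k'

  abundant-¬k : AbundantOn Q (Not k)
  abundant-¬k = proj₁ (proj₂ key)

  abundant-¬k' : AbundantOn Q (Not k')
  abundant-¬k' = proj₁ (proj₂ (proj₂ (proj₂ key)))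

  inherited : ∀ {X x y} → AgreesAway X Q k k' → (∀ {v} → Away x y v → Away k k' v) →
    AbundantOn X (Away x y) × AcyclicOn X (Away x y)
  inherited {X} {x} {y} agrees ⊆V =
    AbundantOn-transfer (proj₁ ∘ ⊆V) X≡Q abundant-¬k ,
    AcyclicOn-transfer {X = X} {Q} {Away x y} {Not k} (proj₁ ∘ ⊆V) X≡Q (proj₁ (proj₂ (proj₂ key)))
    where
    X≡Q : ∀ {a b} → Away x y a → Away x y b → X a b ≡ Q a b
    X≡Q a-away b-away with ⊆V a-away | ⊆V b-away
    ... | a≢k , a≢k' | b≢k , b≢k' = agrees _ _ a≢k a≢k' b≢k b≢k'

  into-k-and-k' : ∀ {v} → Away k k' v → In Q k v × In Q k' v
  into-k-and-k' {v} (v≢k , v≢k') with proj₂ (proj₂ (proj₂ (proj₂ (proj₂ key)))) v v≢k v≢k'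
  ... | inj₁ (k→v , _) = ⊥-elim (sink v k→v)
  ... | inj₂ v→k,k'    = v→k,k'

  into-k : ∀ {v} → Away k k' v → + 2 ≤ Q v k
  into-k {v} v-away@(v≢k , v≢k') =
    2≤∣∣⇒+2≤ (abundant-¬k' v k v≢k' k≢k' v≢k) (proj₁ (into-k-and-k' v-away))

  into-k' : ∀ {v} → Away k k' v → + 2 ≤ Q v k'
  into-k' {v} v-away@(v≢k , v≢k') =
    2≤∣∣⇒+2≤ (abundant-¬k v k' v≢k k'≢k v≢k') (proj₂ (into-k-and-k' v-away))

  k'-below-V : ∀ {v} → Away k k' v → Q k' v < 0ℤ
  k'-below-V v-away = 0<⇒<0 (+2≤⇒0< (into-k' v-away))

  k'k-nonneg : 0ℤ ≤ Q k' k
  k'k-nonneg = subst (0ℤ ≤_) (antisym k k') (neg-mono-≤ (≮⇒≥ (sink k')))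

  R : Mat n
  R = μ k Q

  R-quiver : IsQuiver R
  R-quiver = μ-isQuiver sk k

  R-off-k : ∀ {a b} → a ≢ k → b ≢ k → R a b ≡ Q a b
  R-off-k {a} {b} a≢k b≢k = μ-unchanged a≢k b≢k (inj₂ (≮⇒≥ (sink b))) (inj₂ (≮⇒≥ (sink a)))

  R-agrees : AgreesAway R Q k k'
  R-agrees i j i≢k _ j≢k _ = R-off-k i≢k j≢k

  R-from-k : ∀ v → R k v ≡ Q v k
  R-from-k v = trans (μ-row k v) (antisym k v)

  R-kk'-nonneg : 0ℤ ≤ R k k'
  R-kk'-nonneg = subst (0ℤ ≤_) (sym (R-from-k k')) k'k-nonneg

  R-transit : Transit R k k'
  R-transit = record
    { abundant-away = proj₁ (inherited R-agrees (λ z → z))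
    ; acyclic-away  = proj₂ (inherited R-agrees (λ z → z))
    ; enter         = λ {v} v-away → subst (+ 2 ≤_) (sym (R-from-k v)) (into-k v-away)
    ; leave         = R-leave
    ; return-bound  = λ v-away → inj₁ (≤-<-trans (neg-mono-≤ R-kk'-nonneg) (+2≤⇒0< (R-leave v-away)))
    }
    where
    R-leave : ∀ {v} → Away k k' v → + 2 ≤ R v k'
    R-leave v-away = subst (+ 2 ≤_) (sym (R-off-k (proj₁ v-away) k'≢k)) (into-k' v-away)

  part₁ : IsQuiver R × Acyclic R × ForkingPair R Q k k'
  part₁ = R-quiver , TransitFacts.acyclic R-quiver R-transit R-kk'-nonneg ,
          forkingPair R-quiver (inj₁ R-transit) R-agrees

  P : Mat n
  P = μ k' R

  P-quiver : IsQuiver P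
  P-quiver = μ-isQuiver R-quiver k'

  R-k'-nonpos : ∀ {v} → v ≢ k' → R k' v ≤ 0ℤ
  R-k'-nonpos {v} v≢k' = by-cases (v ≟ k)
    where
    by-cases : Dec (v ≡ k) → R k' v ≤ 0ℤ
    by-cases (yes refl) = subst (_≤ 0ℤ) (sym (μ-col k k')) (neg-mono-≤ k'k-nonneg)
    by-cases (no v≢k)   = subst (_≤ 0ℤ) (sym (R-off-k k'≢k v≢k)) (<⇒≤ (k'-below-V (v≢k , v≢k')))

  P-unchanged : ∀ {a b} → a ≢ k' → b ≢ k' → P a b ≡ R a b
  P-unchanged a≢k' b≢k' = μ-unchanged a≢k' b≢k' (inj₂ (R-k'-nonpos b≢k')) (inj₂ (R-k'-nonpos a≢k'))

  P-agrees : AgreesAway P Q k k'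
  P-agrees i j i≢k i≢k' j≢k j≢k' = trans (P-unchanged i≢k' j≢k') (R-off-k i≢k j≢k)

  P-into-k : ∀ {v} → Away k k' v → P v k ≡ - Q v k
  P-into-k {v} (_ , v≢k') = trans (P-unchanged v≢k' k≢k') (μ-col k v)

  P-into-k' : ∀ {v} → Away k k' v → P v k' ≡ - Q v k'
  P-into-k' {v} (v≢k , _) = trans (μ-col k' v) (cong -_ (R-off-k v≢k k'≢k))

  P-kk' : P k k' ≡ Q k k'
  P-kk' = trans (μ-col k' k) (trans (cong -_ (R-from-k k')) (antisym k' k))

  P-from-k-and-k' : ∀ {v} → Away k k' v → + 2 ≤ P k v × + 2 ≤ P k' v
  P-from-k-and-k' {v} v-away =
    subst (+ 2 ≤_) (reversed (P-into-k v-away)) (into-k v-away) ,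
    subst (+ 2 ≤_) (reversed (P-into-k' v-away)) (into-k' v-away)
    where
    reversed : ∀ {x} → P v x ≡ - Q v x → Q v x ≡ P x v
    reversed {x} eq = trans (sym (neg-involutive _)) (trans (cong -_ (sym eq)) (QuiverFacts.antisym P-quiver v x))

  part₂ : IsQuiver P × ReflectedKey P Q k k'
  part₂ = P-quiver ,
    isKey-of-sources P-quiver k≢k' (proj₁ V-inherited) (proj₂ V-inherited) P-from-k-and-k' ,
    (λ i i≢k i≢k' → P-into-k (i≢k , i≢k') , P-into-k' (i≢k , i≢k')) ,
    P-kk' ,
    P-agrees
    where
    V-inherited = inherited P-agrees (λ z → z)

  module Cyclic (k'→k : 0ℤ < Q k' k) {v₀} (v₀-away : Away k k' v₀) where

    s : Fin n → ℤ
    s v = Q v k + Q v k' * Q k' k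

    s-bound : ∀ {v} → Away k k' v → + 2 ≤ s v × Q k' k < s v
    s-bound v-away = two-step-bound (into-k v-away) (into-k' v-away) (<⇒≤ k'→k)

    t : Fin n → ℤ
    t v = - Q v k' + s v * Q k' k

    R' : Mat n
    R' = μ k' Q

    R'-quiver : IsQuiver R'
    R'-quiver = μ-isQuiver sk k'

    R'-agrees : AgreesAway R' Q k k'
    R'-agrees i j i≢k i≢k' j≢k j≢k' =
      μ-unchanged i≢k' j≢k' (inj₂ (<⇒≤ (k'-below-V (j≢k , j≢k'))))
                            (inj₂ (<⇒≤ (k'-below-V (i≢k , i≢k'))))

    R'-from-k' : ∀ v → R' k' v ≡ Q v k'
    R'-from-k' v = trans (μ-row k' v) (antisym k' v)

    R'-into-k : ∀ {v} → Away k k' v → R' v k ≡ s v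
    R'-into-k v-away@(_ , v≢k') = μ-through sk v≢k' k≢k' (<⇒≤ (+2≤⇒0< (into-k' v-away))) (<⇒≤ k'→k)

    R'-k'k : R' k' k ≡ - Q k' k
    R'-k'k = μ-row k' k

    R'-transit : Transit R' k' k
    R'-transit = record
      { abundant-away = proj₁ (inherited R'-agrees Product.swap)
      ; acyclic-away  = proj₂ (inherited R'-agrees Product.swap)
      ; enter         = λ {v} v-away → subst (+ 2 ≤_) (sym (R'-from-k' v)) (into-k' (Product.swap v-away))
      ; leave         = λ v-away → subst (+ 2 ≤_) (sym (R'-into-k (Product.swap v-away)))
                                     (proj₁ (s-bound (Product.swap v-away)))
      ; return-bound  = λ v-away → inj₁ (subst₂ _<_ (sym (trans (cong -_ R'-k'k) (neg-involutive _)))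
                                                     (sym (R'-into-k (Product.swap v-away)))
                                                     (proj₂ (s-bound (Product.swap v-away))))
      }

    part₃ : IsQuiver R' × ¬ Acyclic R' × ForkingPair R' Q k k'
    part₃ = R'-quiver ,
      TransitFacts.¬acyclic R'-quiver R'-transit (subst (_< 0ℤ) (sym R'-k'k) (neg-mono-< k'→k))
        (Product.swap v₀-away) ,
      forkingPair R'-quiver (inj₂ R'-transit) R'-agrees

    P' : Mat n
    P' = μ k R'

    P'-quiver : IsQuiver P'
    P'-quiver = μ-isQuiver R'-quiver k

    R'-k-neg : ∀ {v} → Away k k' v → R' k v < 0ℤ
    R'-k-neg {v} v-away =
      QuiverFacts.0<⇒<0 R'-quiver {v} {k}
        (subst (0ℤ <_) (sym (R'-into-k v-away)) (+2≤⇒0< (proj₁ (s-bound v-away))))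

    R'-kk' : R' k k' ≡ Q k' k
    R'-kk' = trans (μ-col k' k) (antisym k k')

    P'-agrees : AgreesAway P' Q k k'
    P'-agrees i j i≢k i≢k' j≢k j≢k' =
      trans (μ-unchanged i≢k j≢k (inj₂ (<⇒≤ (R'-k-neg (j≢k , j≢k'))))
                                 (inj₂ (<⇒≤ (R'-k-neg (i≢k , i≢k')))))
        (R'-agrees i j i≢k i≢k' j≢k j≢k')

    P'-from-k : ∀ {v} → Away k k' v → P' k v ≡ s v
    P'-from-k {v} v-away = trans (μ-row k v) (trans (QuiverFacts.antisym R'-quiver k v) (R'-into-k v-away))

    P'-into-k' : ∀ {v} → Away k k' v → P' v k' ≡ t v
    P'-into-k' {v} v-away@(v≢k , _) = begin
      P' v k'                      ≡⟨ μ-through R'-quiver v≢k k'≢k (<⇒≤ v→k) (<⇒≤ k→k') ⟩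
      R' v k' + R' v k * R' k k'   ≡⟨ cong₂ _+_ (μ-col k' v) (cong₂ _*_ (R'-into-k v-away) R'-kk') ⟩
      - Q v k' + s v * Q k' k      ∎
      where
      open ≡-Reasoning
      v→k : 0ℤ < R' v k
      v→k = subst (0ℤ <_) (sym (R'-into-k v-away)) (+2≤⇒0< (proj₁ (s-bound v-away)))
      k→k' : 0ℤ < R' k k'
      k→k' = subst (0ℤ <_) (sym R'-kk') k'→k

    P'-kk' : P' k k' ≡ - Q k' k
    P'-kk' = trans (μ-row k k') (cong -_ R'-kk')

    P'-transit : Transit P' k k'
    P'-transit = record
      { abundant-away = proj₁ (inherited P'-agrees (λ z → z))
      ; acyclic-away  = proj₂ (inherited P'-agrees (λ z → z))
      ; enter         = λ v-away → subst (+ 2 ≤_) (sym (P'-from-k v-away)) (proj₁ (s-bound v-away))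
      ; leave         = λ v-away → subst (+ 2 ≤_) (sym (P'-into-k' v-away))
                                     (three-step-bound (into-k v-away) (into-k' v-away) k'→k)
      ; return-bound  = λ v-away → inj₂ (subst₂ _<_ (sym (trans (cong -_ P'-kk') (neg-involutive _)))
                                                     (sym (P'-from-k v-away)) (proj₂ (s-bound v-away)))
      }

    part₄ : IsQuiver P' × ¬ Acyclic P' × ForkingPair P' Q k k'
    part₄ = P'-quiver ,
      TransitFacts.¬acyclic P'-quiver P'-transit (subst (_< 0ℤ) (sym P'-kk') (neg-mono-< k'→k)) v₀-away ,
      forkingPair P'-quiver (inj₁ P'-transit) P'-agrees

  module _ (k'-mixed : ¬ (Sink Q k' ⊎ Source Q k')) where

    k'→k : 0ℤ < Q k' k
    k'→k with ∃-positive (Q k') (k'-mixed ∘ inj₁)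
    ... | j , k'→j with locate k k' j
    ...   | inj₁ refl          = k'→j
    ...   | inj₂ (inj₁ refl)   = ⊥-elim (¬0<diagonal k'→j)
    ...   | inj₂ (inj₂ j-away) = ⊥-elim (<-asym k'→j (k'-below-V j-away))

    v₀ : Σ (Fin n) (Away k k')
    v₀ with ∃-positive (λ j → Q j k') (k'-mixed ∘ inj₂)
    ... | j , j→k' with locate k k' j
    ...   | inj₁ refl          = ⊥-elim (sink k' j→k')
    ...   | inj₂ (inj₁ refl)   = ⊥-elim (¬0<diagonal j→k')
    ...   | inj₂ (inj₂ j-away) = j , j-away

    open Cyclic k'→k (proj₂ v₀) public using (part₃; part₄)

  keyMutationFacts : KeyMutationFacts Q k k'
  keyMutationFacts = part₁ , part₂ , part₃ , part₄

keyMutationFacts-transpose : ∀ {Q : Mat n} {k k'} → IsQuiver Q →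
  KeyMutationFacts (transpose Q) k k' → KeyMutationFacts Q k k'
keyMutationFacts-transpose {Q = Q} {k} {k'} sk ((skR , acR , pairR) , (skP , keyP) , part₃ , part₄) =
  (isQuiver T₁ skR , acyclicOn T₁ (λ z → z) acR , forkingPair-transposed T₁ skR pairR) ,
  (isQuiver T₂ skP , reflectedKey-transposed T₂ skP keyP) ,
  (λ mixed → cyclic-transposed T₃ (part₃ (mixed ∘ Sum.swap))) ,
  (λ mixed → cyclic-transposed T₄ (part₄ (mixed ∘ Sum.swap)))
  where
  open Transposition
  T₀ : Transposed (transpose Q) Q
  T₀ _ _ = refl
  T₁ = μ-transposed T₀ k
  T₂ = μ-transposed T₁ k'
  T₃ = μ-transposed T₀ k'
  T₄ = μ-transposed T₃ k

  forkingPair-transposed : ∀ {X Y} → Transposed X Y → IsQuiver X →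
    ForkingPair X (transpose Q) k k' → ForkingPair Y Q k k'
  forkingPair-transposed T skX (full , forks , agrees) =
    keySetFull T (isQuiver T skX) full , forksAway-transposed T forks , agreesAway T T₀ agrees

  cyclic-transposed : ∀ {X Y} → Transposed X Y →
    IsQuiver X × ¬ Acyclic X × ForkingPair X (transpose Q) k k' → IsQuiver Y × ¬ Acyclic Y × ForkingPair Y Q k k'
  cyclic-transposed T (skX , ¬ac , pairX) = isQuiver T skX , ¬acyclic T ¬ac , forkingPair-transposed T skX pairX

  reflectedKey-transposed : ∀ {X Y} → Transposed X Y → IsQuiver X →
    ReflectedKey X (transpose Q) k k' → ReflectedKey Y Q k k'
  reflectedKey-transposed {X} {Y} T skX (keyX , arms , kk' , agrees) =
    isKey T keyX ,
    (λ i i≢k i≢k' → Product.map reversed reversed (arms i i≢k i≢k')) ,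
    kept kk' ,
    agreesAway T T₀ agrees
    where
    open ≡-Reasoning
    reversed : ∀ {i j} → X i j ≡ - Q j i → Y i j ≡ - Q i j
    reversed {i} {j} eq = begin
      Y i j     ≡⟨ T i j ⟩
      X j i     ≡⟨ skX j i ⟩
      - X i j   ≡⟨ cong -_ eq ⟩
      - - Q j i ≡⟨ neg-involutive _ ⟩
      Q j i     ≡⟨ sk j i ⟩
      - Q i j   ∎
    kept : X k k' ≡ Q k' k → Y k k' ≡ Q k k'
    kept eq = begin
      Y k k'    ≡⟨ T k k' ⟩
      X k' k    ≡⟨ skX k' k ⟩
      - X k k'  ≡⟨ cong -_ eq ⟩
      - Q k' k  ≡⟨ sym (sk k k') ⟩
      Q k k'    ∎

lemma4p13 : ∀ {n : ℕ} (Q : Mat n) (k k' : Fin n) →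
    IsQuiver Q → IsKey Q k k' → (Sink Q k ⊎ Source Q k) →
    -- (1) R = μ_k Q
    (IsQuiver (μ k Q) × Acyclic (μ k Q) × KeySetFull (μ k Q) k k' ×
      ForksAway (μ k Q) k k' × AgreesAway (μ k Q) Q k k')
    -- (2) P = μ_[k,k'] Q
    × (IsQuiver (μ[ k , k' ] Q) × IsKey (μ[ k , k' ] Q) k k' ×
      (∀ (i : Fin n) → i ≢ k → i ≢ k' →
         (μ[ k , k' ] Q i k ≡ - Q i k) × (μ[ k , k' ] Q i k' ≡ - Q i k')) ×
      (μ[ k , k' ] Q k k' ≡ Q k k') × AgreesAway (μ[ k , k' ] Q) Q k k')
    -- (3) R' = μ_k' Q
    × (¬ (Sink Q k' ⊎ Source Q k') →
      IsQuiver (μ k' Q) × ¬ Acyclic (μ k' Q) × KeySetFull (μ k' Q) k k' ×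
      ForksAway (μ k' Q) k k' × AgreesAway (μ k' Q) Q k k')
    -- (4) P' = μ_[k',k] Q
    × (¬ (Sink Q k' ⊎ Source Q k') →
      IsQuiver (μ[ k' , k ] Q) × ¬ Acyclic (μ[ k' , k ] Q) ×
      KeySetFull (μ[ k' , k ] Q) k k' ×
      ForksAway (μ[ k' , k ] Q) k k' × AgreesAway (μ[ k' , k ] Q) Q k k')
lemma4p13 Q k k' sk key (inj₁ sink)   = SinkKey.keyMutationFacts sk key sink
lemma4p13 Q k k' sk key (inj₂ source) = keyMutationFacts-transpose sk
  (SinkKey.keyMutationFacts (Transposition.isQuiver T sk) (Transposition.isKey T key) source)
  where
  T : Transposed Q (transpose Q)
  T _ _ = refl
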